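{- Let $\Gamma\le\mathbf{Sym}_n$. If $C$ is a $\Gamma$-symmetric $\mathrm{MOD}_m$-circuit on $x_1,\dots,x_n$, then there exists a rigid $\Gamma$-symmetric $\mathrm{MOD}_m$-circuit $C'$ that computes the same function as $C$ and satisfies $|C'|\le|C|$.
   Context: $\mathrm{MOD}_m^R$ ($R\subseteq\mathbb{Z}_m$) outputs $1$ on Boolean inputs iff their sum mod $m$ lies in $R$. A $\mathrm{MOD}_m$-circuit on $x_1,\dots,x_n$ is a finite DAG (multiple wires allowed) with a single output gate, exactly one input gate per variable, other gates labelled by some $\mathrm{MOD}_m^R$ and evaluated on children's values counted with wire multiplicity; $|C|$ is the number of gates plus the number of wires counted with multiplicity. $C$ is $\Gamma$-symmetric if every $\pi\in\Gamma$ extends to a circuit automorphism (bijection of gates preserving internal gate labels and wire multiplicities) mapping the input gate of $x_i$ to that of $x_{\pi(i)}$. $C$ is rigid if the only circuit automorphism fixing every input gate is the identity. -}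

module Defs where

open import Data.Nat using (ℕ; zero; suc; _+_; _*_; _≤_; _<_; NonZero)
open import Data.Nat.DivMod using (_mod_)
open import Data.Fin using (Fin)
open import Data.Fin.Permutation using (Permutation′; _⟨$⟩ʳ_; id; flip; _∘ₚ_)
open import Data.Bool using (Bool; true; false; if_then_else_)
open import Data.List using (List; map; allFin)
open import Data.Nat.ListAction using (sum)
open import Data.Product using (Σ; ∃; _×_; _,_)
open import Relation.Binary.PropositionalEquality using (_≡_; _≢_)

Σ[_] : (g : ℕ) → (Fin g → ℕ) → ℕ
Σ[ g ] f = sum (map f (allFin g))

-- A subset R ⊆ ℤ_m is given by its characteristic function Fin m → Bool.
-- Gate labels: an input gate for variable i, or an internal gate MOD_m^R.
data Label (n m : ℕ) : Set where
  input : Fin n → Label n m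
  modg  : (Fin m → Bool) → Label n m

-- A MOD_m circuit on x_1..x_n.  Gates are Fin g; W u v is the number of
-- wires from gate v into gate u (v is a child of u, counted with multiplicity).
record Circuit (n m : ℕ) : Set where
  field
    g      : ℕ
    label  : Fin g → Label n m
    W      : Fin g → Fin g → ℕ
    -- acyclicity (finite DAG): a rank function strictly decreasing along wires
    rank   : Fin g → ℕ
    rank-dec : ∀ u v → W u v ≢ 0 → rank v < rank u
    inp    : Fin n → Fin g
    inp-label : ∀ i → label (inp i) ≡ input i
    inp-unique : ∀ u i → label u ≡ input i → u ≡ inp i
    inp-leaf : ∀ u i v → label u ≡ input i → W u v ≡ 0
    out    : Fin g
    out-noparent : ∀ u → W u out ≡ 0
    others-parent : ∀ v → v ≢ out → ∃ λ u → W u v ≢ 0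

module _ {n m : ℕ} .{{_ : NonZero m}} (C : Circuit n m) (x : Fin n → Bool) where
  open Circuit C

  bit : Bool → ℕ
  bit true  = 1
  bit false = 0

  -- evaluation with fuel; fuel g suffices since every path has ≤ g gates
  evalF : ℕ → Fin g → Bool
  evalF zero u = false
  evalF (suc k) u with label u
  ... | input i = x i
  ... | modg R  = R ((Σ[ g ] λ v → W u v * bit (evalF k v)) mod m)

  value : Fin g → Bool
  value = evalF g

  output : Bool
  output = value out

size : ∀ {n m} → Circuit n m → ℕ
size C = g + Σ[ g ] (λ u → Σ[ g ] (λ v → W u v)) where open Circuit C

IsAutomorphism : ∀ {n m} (C : Circuit n m) → Permutation′ (Circuit.g C) → Set
IsAutomorphism C σ =
  (∀ u R → label u ≡ modg R → label (σ ⟨$⟩ʳ u) ≡ modg R) ×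
  (∀ u v → W (σ ⟨$⟩ʳ u) (σ ⟨$⟩ʳ v) ≡ W u v)
  where open Circuit C

record IsSubgroup {n : ℕ} (Γ : Permutation′ n → Set) : Set where
  field
    has-id  : Γ id
    has-∘   : ∀ π ρ → Γ π → Γ ρ → Γ (π ∘ₚ ρ)
    has-inv : ∀ π → Γ π → Γ (flip π)

Symmetric : ∀ {n m} (Γ : Permutation′ n → Set) → Circuit n m → Set
Symmetric Γ C = ∀ π → Γ π →
  Σ (Permutation′ g) λ σ → IsAutomorphism C σ × (∀ i → σ ⟨$⟩ʳ inp i ≡ inp (π ⟨$⟩ʳ i))
  where open Circuit C

Rigid : ∀ {n m} → Circuit n m → Set
Rigid C = ∀ (σ : Permutation′ g) → IsAutomorphism C σ →
  (∀ i → σ ⟨$⟩ʳ inp i ≡ inp i) → ∀ u → σ ⟨$⟩ʳ u ≡ u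
  where open Circuit C

-- Call two gates twins if they carry the same label, have the same children with the same
-- multiplicities, and are both or neither the output gate. Identifying every class of twins
-- gives a circuit that computes the same function with no more gates and wires, and every
-- automorphism permutes the twin classes, so Γ-symmetry descends to the merged circuit.
-- If a circuit has no two distinct twins it is rigid: an automorphism fixing the inputs
-- fixes, by induction on depth, all children of a gate, hence maps the gate to a twin of
-- itself. Merging repeatedly strictly decreases the number of gates until this happens.

module Submission where

open import Defs
open import Level using (0ℓ)
open import Data.Nat using (ℕ; zero; suc; _+_; _*_; _≤_; _<_; _<?_; z≤n; s≤s; NonZero)
open import Data.Nat using () renaming (_≟_ to _≟ℕ_)
open import Data.Nat.DivMod using (_mod_)
open import Data.Nat.ListAction using () renaming (sum to sumList)
open import Data.Nat.Properties
  using (≤-refl; ≤-trans; ≤-reflexive; <-trans; <-irrefl; <-≤-trans; ≤-<-trans; n≮0;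
         +-identityʳ; +-mono-≤; +-monoʳ-≤; +-mono-<-≤; +-mono-≤-<; m≤m+n; m≤n+m; n≤0⇒n≡0; ≤-pred;
         ≤-totalOrder; +-*-semiring; module ≤-Reasoning)
open import Data.Fin using (Fin; zero; suc; punchIn; punchOut)
open import Data.Fin.Properties
  using (_≟_; any?; all?; suc-injective; injective⇒≤; punchIn-punchOut; punchOut-injective; toℕ<n)
open import Data.Fin.Permutation
  using (Permutation′; _⟨$⟩ʳ_; _⟨$⟩ˡ_; inverseˡ; inverseʳ; permutation; flip)
open import Data.Bool using (Bool; true; false)
import Data.Bool.Properties as Bool
open import Data.List using (tabulate)
open import Data.List.Properties using (map-tabulate)
open import Data.List.Extrema.Core ≤-totalOrder using (⊓ᴸ; ⊓ᴸ-sel; ⊓ᴸ-presᵒ-≤v)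
open import Data.Vec using (lookup) renaming (tabulate to tabulateᵛ)
open import Data.Vec.Properties using (lookup∘tabulate; tabulate-cong)
open import Data.Product using (Σ; ∃; ∃₂; _×_; _,_; proj₁; proj₂)
open import Data.Sum using (_⊎_; inj₁; inj₂)
open import Data.Empty using (⊥; ⊥-elim)
open import Function using (_∘_; _on_; Injective)
open import Relation.Nullary using (Dec; yes; no; ¬_)
open import Relation.Nullary.Decidable using (_×-dec_; _→-dec_; map′; ¬?; decidable-stable)
open import Relation.Binary.Core using (Rel)
open import Relation.Binary.Structures using (IsDecEquivalence)
import Relation.Binary.Construct.On as On
open import Relation.Binary.PropositionalEquality
open import Algebra.Properties.Semiring.Sum +-*-semiring
  using (sum; sum-cong-≗; sum-remove; ∑-comm; ∑-permute; *-distribʳ-sum)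

Σ≡sum : ∀ g (f : Fin g → ℕ) → Σ[ g ] f ≡ sum f
Σ≡sum g f = trans (cong sumList (map-tabulate (λ i → i) f)) (sum-tabulate g f)
  where
  sum-tabulate : ∀ g (f : Fin g → ℕ) → sumList (tabulate f) ≡ sum f
  sum-tabulate zero    f = refl
  sum-tabulate (suc g) f = cong (f zero +_) (sum-tabulate g (f ∘ suc))

sum-mono-≤ : ∀ {g} {f h : Fin g → ℕ} → (∀ i → f i ≤ h i) → sum f ≤ sum h
sum-mono-≤ {zero}  f≤h = z≤n
sum-mono-≤ {suc g} f≤h = +-mono-≤ (f≤h zero) (sum-mono-≤ (f≤h ∘ suc))

sum-mono-< : ∀ {g} {f h : Fin g → ℕ} → (∀ i → f i ≤ h i) → ∀ i → f i < h i → sum f < sum h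
sum-mono-< f≤h zero    fi<hi = +-mono-<-≤ fi<hi (sum-mono-≤ (f≤h ∘ suc))
sum-mono-< f≤h (suc i) fi<hi = +-mono-≤-< (f≤h zero) (sum-mono-< (f≤h ∘ suc) i fi<hi)

≤-sum : ∀ {g} (f : Fin g → ℕ) i → f i ≤ sum f
≤-sum f zero    = m≤m+n _ _
≤-sum f (suc i) = ≤-trans (≤-sum (f ∘ suc) i) (m≤n+m _ _)

sum-zero : ∀ {g} {f : Fin g → ℕ} → (∀ i → f i ≡ 0) → sum f ≡ 0
sum-zero {zero}  f≡0 = refl
sum-zero {suc g} f≡0 = cong₂ _+_ (f≡0 zero) (sum-zero (f≡0 ∘ suc))

sum≢0⇒∃≢0 : ∀ {g} (f : Fin g → ℕ) → sum f ≢ 0 → ∃ λ i → f i ≢ 0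
sum≢0⇒∃≢0 {zero}  f sum≢0 = ⊥-elim (sum≢0 refl)
sum≢0⇒∃≢0 {suc g} f sum≢0 with f zero ≟ℕ 0
... | no f₀≢0 = zero , f₀≢0
... | yes f₀≡0 with sum≢0⇒∃≢0 (f ∘ suc) (sum≢0 ∘ cong₂ _+_ f₀≡0)
...   | i , fi≢0 = suc i , fi≢0

sum-const-1 : ∀ g → sum {g} (λ _ → 1) ≡ g
sum-const-1 zero    = refl
sum-const-1 (suc g) = cong suc (sum-const-1 g)

keepIf : ∀ {p} {P : Set p} → Dec P → ℕ → ℕ
keepIf (yes _) x = x
keepIf (no _)  x = 0

keepIf-yes : ∀ {p} {P : Set p} (d : Dec P) → P → ∀ x → keepIf d x ≡ x
keepIf-yes (yes _) _ x = refl
keepIf-yes (no ¬p) p x = ⊥-elim (¬p p)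

keepIf-zero : ∀ {p} {P : Set p} (d : Dec P) → keepIf d 0 ≡ 0
keepIf-zero (yes _) = refl
keepIf-zero (no _)  = refl

keepIf-cong : ∀ {p q} {P : Set p} {Q : Set q} (d : Dec P) (d′ : Dec Q) → (P → Q) → (Q → P) →
              ∀ x → keepIf d x ≡ keepIf d′ x
keepIf-cong (yes _) (yes _)  _   _   x = refl
keepIf-cong (yes p) (no ¬q)  p→q _   x = ⊥-elim (¬q (p→q p))
keepIf-cong (no ¬p) (yes q)  _   q→p x = ⊥-elim (¬p (q→p q))
keepIf-cong (no _)  (no _)   _   _   x = refl

sum-keepIf-≟ : ∀ {g} (i : Fin g) x → sum (λ j → keepIf (i ≟ j) x) ≡ x
sum-keepIf-≟ {suc g} zero    x = trans (cong (x +_) (sum-zero {g} λ _ → refl)) (+-identityʳ x)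
sum-keepIf-≟ {suc g} (suc i) x = trans (cong (_ +_) (sum-cong-≗ keepIf-suc)) (sum-keepIf-≟ i x)
  where
  keepIf-suc : ∀ j → keepIf (suc i ≟ suc j) x ≡ keepIf (i ≟ j) x
  keepIf-suc j with i ≟ j
  ... | yes _ = refl
  ... | no  _ = refl

sum-∘-injective : ∀ {k g} (s : Fin k → Fin g) → Injective _≡_ _≡_ s → (f : Fin g → ℕ) →
                  sum (f ∘ s) ≤ sum f
sum-∘-injective {zero}          s s-inj f = z≤n
sum-∘-injective {suc k} {zero}  s s-inj f with s zero
... | ()
sum-∘-injective {suc k} {suc g} s s-inj f = begin
  f (s zero) + sum (f ∘ s ∘ suc)
    ≡⟨ cong (f (s zero) +_) (sum-cong-≗ (cong f ∘ sym ∘ punchIn-punchOut ∘ s₀≢)) ⟩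
  f (s zero) + sum (f ∘ punchIn (s zero) ∘ s′)
    ≤⟨ +-monoʳ-≤ (f (s zero)) (sum-∘-injective s′ s′-inj (f ∘ punchIn (s zero))) ⟩
  f (s zero) + sum (f ∘ punchIn (s zero))
    ≡⟨ sum-remove f ⟨
  sum f
    ∎
  where
  open ≤-Reasoning
  s₀≢ : ∀ j → s zero ≢ s (suc j)
  s₀≢ j eq with s-inj eq
  ... | ()
  s′ : Fin k → Fin g
  s′ j = punchOut (s₀≢ j)
  s′-inj : Injective _≡_ _≡_ s′
  s′-inj eq = suc-injective (s-inj (punchOut-injective (s₀≢ _) (s₀≢ _) eq))

sum-cong-weighted : ∀ {g} (c : Fin g → ℕ) {a b : Fin g → ℕ} →
                    (∀ v → c v ≢ 0 → a v ≡ b v) → sum (λ v → c v * a v) ≡ sum (λ v → c v * b v)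
sum-cong-weighted c {a} {b} a≡b = sum-cong-≗ term
  where
  term : ∀ v → c v * a v ≡ c v * b v
  term v with c v ≟ℕ 0
  ... | yes cv≡0 = trans (cong (_* a v) cv≡0) (sym (cong (_* b v) cv≡0))
  ... | no  cv≢0 = cong (c v *_) (a≡b v cv≢0)

sum-fibres : ∀ {g k} (c : Fin g → Fin k) (f : Fin g → ℕ) →
             sum (λ b → sum (λ w → keepIf (c w ≟ b) (f w))) ≡ sum f
sum-fibres c f =
  trans (∑-comm (λ b w → keepIf (c w ≟ b) (f w))) (sum-cong-≗ λ w → sum-keepIf-≟ (c w) (f w))

injective-non-surjective⇒< : ∀ {k g} (s : Fin k → Fin g) → Injective _≡_ _≡_ s →
                             ∀ y → (∀ b → s b ≢ y) → k < g
injective-non-surjective⇒< {g = suc g} s s-inj y y∉s = s≤s (injective⇒≤ s′-inj)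
  where
  s′-inj : Injective _≡_ _≡_ (λ b → punchOut (y∉s b ∘ sym))
  s′-inj eq = s-inj (punchOut-injective (y∉s _ ∘ sym) (y∉s _ ∘ sym) eq)

-- Quotients of Fin g by a decidable equivalence

record Quotient {g} (_≈_ : Rel (Fin g) 0ℓ) (key : Fin g → ℕ) : Set where
  field
    classes        : ℕ
    class          : Fin g → Fin classes
    rep            : Fin classes → Fin g
    class-rep      : ∀ c → class (rep c) ≡ c
    class-sound    : ∀ {u w} → class u ≡ class w → u ≈ w
    class-complete : ∀ {u w} → u ≈ w → class u ≡ class w
    rep-minimal    : ∀ u → key (rep (class u)) ≤ key u

  rep-≈ : ∀ u → rep (class u) ≈ u
  rep-≈ u = class-sound (class-rep (class u))

  rep-injective : Injective _≡_ _≡_ rep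
  rep-injective {a} {b} eq = trans (sym (class-rep a)) (trans (cong class eq) (class-rep b))

  classes≤ : classes ≤ g
  classes≤ = injective⇒≤ rep-injective

  rep-class : ∀ {b u} → rep b ≡ u → rep (class u) ≡ u
  rep-class {b} refl = cong rep (class-rep b)

  classes< : ∀ {u w} → u ≈ w → u ≢ w → classes < g
  classes< {u} {w} u≈w u≢w with rep (class u) ≟ u
  ... | no  ¬rep-u = injective-non-surjective⇒< rep rep-injective u (λ b → ¬rep-u ∘ rep-class)
  ... | yes rep-u  = injective-non-surjective⇒< rep rep-injective w λ b rep≡w →
    u≢w (trans (sym rep-u) (trans (cong rep (class-complete u≈w)) (rep-class rep≡w)))

module _ {g} {_≈_ : Rel (Fin (suc g)) 0ℓ} (≈-dec : IsDecEquivalence _≈_) (key : Fin (suc g) → ℕ)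
         (Q : Quotient (_≈_ on suc) (key ∘ suc)) where
  open IsDecEquivalence ≈-dec using () renaming (refl to ≈-refl; sym to ≈-sym; trans to ≈-trans)
  open Quotient Q

  ≈-suc-rep : ∀ u c → class u ≡ c → suc u ≈ suc (rep c)
  ≈-suc-rep u c refl = ≈-sym (rep-≈ u)

  extend-fresh : (∀ c → ¬ zero ≈ suc (rep c)) → Quotient _≈_ key
  extend-fresh zero≉ = record
    { classes = suc classes ; class = class′ ; rep = rep′ ; class-rep = class-rep′
    ; class-sound = sound′ ; class-complete = complete′ ; rep-minimal = minimal′ }
    where
    class′ : Fin (suc g) → Fin (suc classes)
    class′ zero    = zero
    class′ (suc u) = suc (class u)
    rep′ : Fin (suc classes) → Fin (suc g)
    rep′ zero    = zero
    rep′ (suc c) = suc (rep c)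
    class-rep′ : ∀ c → class′ (rep′ c) ≡ c
    class-rep′ zero    = refl
    class-rep′ (suc c) = cong suc (class-rep c)
    sound′ : ∀ {u w} → class′ u ≡ class′ w → u ≈ w
    sound′ {zero}  {zero}  _  = ≈-refl
    sound′ {suc u} {suc w} eq = class-sound (suc-injective eq)
    complete′ : ∀ {u w} → u ≈ w → class′ u ≡ class′ w
    complete′ {zero}  {zero}  _   = refl
    complete′ {zero}  {suc w} 0≈w =
      ⊥-elim (zero≉ (class w) (≈-trans 0≈w (≈-suc-rep w _ refl)))
    complete′ {suc u} {zero}  u≈0 =
      ⊥-elim (zero≉ (class u) (≈-trans (≈-sym u≈0) (≈-suc-rep u _ refl)))
    complete′ {suc u} {suc w} u≈w = cong suc (class-complete u≈w)
    minimal′ : ∀ u → key (rep′ (class′ u)) ≤ key u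
    minimal′ zero    = ≤-refl
    minimal′ (suc u) = rep-minimal u

  extend-join : ∀ c → zero ≈ suc (rep c) → Quotient _≈_ key
  extend-join c 0≈c = record
    { classes = classes ; class = class′ ; rep = rep′ ; class-rep = class-rep′
    ; class-sound = sound′ ; class-complete = complete′ ; rep-minimal = minimal′ }
    where
    class′ : Fin (suc g) → Fin classes
    class′ zero    = c
    class′ (suc u) = class u
    best : Fin (suc g)
    best = ⊓ᴸ key zero (suc (rep c))
    rep′ : Fin classes → Fin (suc g)
    rep′ d with d ≟ c
    ... | yes _ = best
    ... | no  _ = suc (rep d)
    class-best : class′ best ≡ c
    class-best with ⊓ᴸ-sel key zero (suc (rep c))
    ... | inj₁ best≡zero = cong class′ best≡zero
    ... | inj₂ best≡rep  = trans (cong class′ best≡rep) (class-rep c)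
    class-rep′ : ∀ d → class′ (rep′ d) ≡ d
    class-rep′ d with d ≟ c
    ... | yes refl = class-best
    ... | no _     = class-rep d
    0≈suc : ∀ {w} → class w ≡ c → zero ≈ suc w
    0≈suc eq = ≈-trans 0≈c (≈-sym (≈-suc-rep _ _ eq))
    suc≈0 : ∀ {w} → suc w ≈ zero → class w ≡ c
    suc≈0 w≈0 = trans (class-complete (≈-trans w≈0 0≈c)) (class-rep c)
    sound′ : ∀ {u w} → class′ u ≡ class′ w → u ≈ w
    sound′ {zero}  {zero}  _  = ≈-refl
    sound′ {zero}  {suc w} eq = 0≈suc (sym eq)
    sound′ {suc u} {zero}  eq = ≈-sym (0≈suc eq)
    sound′ {suc u} {suc w} eq = class-sound eq
    complete′ : ∀ {u w} → u ≈ w → class′ u ≡ class′ w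
    complete′ {zero}  {zero}  _   = refl
    complete′ {zero}  {suc w} 0≈w = sym (suc≈0 (≈-sym 0≈w))
    complete′ {suc u} {zero}  u≈0 = suc≈0 u≈0
    complete′ {suc u} {suc w} u≈w = class-complete u≈w
    minimal′ : ∀ u → key (rep′ (class′ u)) ≤ key u
    minimal′ zero with c ≟ c
    ... | yes _  = ⊓ᴸ-presᵒ-≤v key zero (suc (rep c)) (inj₁ ≤-refl)
    ... | no c≢c = ⊥-elim (c≢c refl)
    minimal′ (suc u) with class u ≟ c | rep-minimal u
    ... | yes refl | min = ≤-trans (⊓ᴸ-presᵒ-≤v key zero (suc (rep c)) (inj₂ ≤-refl)) min
    ... | no _     | min = min

quotient : ∀ {g} {_≈_ : Rel (Fin g) 0ℓ} → IsDecEquivalence _≈_ → (key : Fin g → ℕ) →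
           Quotient _≈_ key
quotient {zero} _ _ = record
  { classes = zero ; class = λ () ; rep = λ () ; class-rep = λ ()
  ; class-sound = λ {} ; class-complete = λ {} ; rep-minimal = λ () }
quotient {suc g} {_≈_} ≈-dec key = extend (any? λ c → zero ≈? suc (rep c))
  where
  open IsDecEquivalence ≈-dec using () renaming (_≟_ to _≈?_)
  Q : Quotient (_≈_ on suc) (key ∘ suc)
  Q = quotient (On.isDecEquivalence suc ≈-dec) (key ∘ suc)
  open Quotient Q
  extend : Dec (∃ λ c → zero ≈ suc (rep c)) → Quotient _≈_ key
  extend (yes (c , 0≈c)) = extend-join ≈-dec key Q c 0≈c
  extend (no 0≉)         = extend-fresh ≈-dec key Q λ c 0≈c → 0≉ (c , 0≈c)

module _ {g} {_≈_ : Rel (Fin g) 0ℓ} {key : Fin g → ℕ} (Q : Quotient _≈_ key) where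
  open Quotient Q

  module _ (σ : Permutation′ g) (σ-resp : ∀ {u w} → u ≈ w → (σ ⟨$⟩ʳ u) ≈ (σ ⟨$⟩ʳ w))
           (σ⁻¹-resp : ∀ {u w} → u ≈ w → (σ ⟨$⟩ˡ u) ≈ (σ ⟨$⟩ˡ w)) where

    quotient-permutation : Permutation′ classes
    quotient-permutation = permutation
      (λ c → class (σ ⟨$⟩ʳ rep c))
      (λ c → class (σ ⟨$⟩ˡ rep c))
      (λ c → trans (class-complete (σ-resp (rep-≈ _))) (trans (cong class (inverseʳ σ)) (class-rep c)))
      (λ c → trans (class-complete (σ⁻¹-resp (rep-≈ _))) (trans (cong class (inverseˡ σ)) (class-rep c)))

    quotient-permutation-class : ∀ u → quotient-permutation ⟨$⟩ʳ class u ≡ class (σ ⟨$⟩ʳ u)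
    quotient-permutation-class u = class-complete (σ-resp (rep-≈ u))

infix 4 _≈ᴸ_

-- MOD sets are compared pointwise, which keeps twinhood decidable; normalise then turns
-- pointwise-equal labels into equal ones, as automorphisms of the merged circuit require.
_≈ᴸ_ : ∀ {n m} → Rel (Label n m) 0ℓ
input i ≈ᴸ input j = i ≡ j
modg R  ≈ᴸ modg S  = ∀ r → R r ≡ S r
_       ≈ᴸ _       = ⊥

≈ᴸ-refl : ∀ {n m} (a : Label n m) → a ≈ᴸ a
≈ᴸ-refl (input i) = refl
≈ᴸ-refl (modg R)  = λ _ → refl

≈ᴸ-sym : ∀ {n m} (a b : Label n m) → a ≈ᴸ b → b ≈ᴸ a
≈ᴸ-sym (input i) (input j) i≡j = sym i≡j
≈ᴸ-sym (modg R)  (modg S)  R≗S = sym ∘ R≗S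

≈ᴸ-trans : ∀ {n m} (a b c : Label n m) → a ≈ᴸ b → b ≈ᴸ c → a ≈ᴸ c
≈ᴸ-trans (input i) (input j) (input k) i≡j j≡k = trans i≡j j≡k
≈ᴸ-trans (modg R)  (modg S)  (modg T)  R≗S S≗T = λ r → trans (R≗S r) (S≗T r)

_≈ᴸ?_ : ∀ {n m} (a b : Label n m) → Dec (a ≈ᴸ b)
input i ≈ᴸ? input j = i ≟ j
input i ≈ᴸ? modg S  = no λ ()
modg R  ≈ᴸ? input j = no λ ()
modg R  ≈ᴸ? modg S  = all? λ r → R r Bool.≟ S r

normalise : ∀ {n m} → Label n m → Label n m
normalise (input i) = input i
normalise (modg R)  = modg (lookup (tabulateᵛ R))

normalise-cong : ∀ {n m} (a b : Label n m) → a ≈ᴸ b → normalise a ≡ normalise b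
normalise-cong (input i) (input j) i≡j = cong input i≡j
normalise-cong (modg R)  (modg S)  R≗S = cong (modg ∘ lookup) (tabulate-cong R≗S)

normalise-input : ∀ {n m} (a : Label n m) i → normalise a ≡ input i → a ≡ input i
normalise-input (input j) i eq = eq

normalise-modg : ∀ {n m} (a : Label n m) R → normalise a ≡ modg R → ∃ λ S → a ≡ modg S
normalise-modg (modg S) R eq = S , refl

module _ {n m} (C : Circuit n m) where
  open Circuit C

  -- The number of gates of smaller rank: a rank function bounded by g, so that the fuel g
  -- used by value suffices.
  rank< : Fin g → ℕ
  rank< u = sum λ w → keepIf (rank w <? rank u) 1

  rank<-dec : ∀ u v → W u v ≢ 0 → rank< v < rank< u
  rank<-dec u v uv≢0 = sum-mono-< ≤-mono v strict
    where
    v<u = rank-dec u v uv≢0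
    ≤-mono : ∀ w → keepIf (rank w <? rank v) 1 ≤ keepIf (rank w <? rank u) 1
    ≤-mono w with rank w <? rank v | rank w <? rank u
    ... | yes _   | yes _   = ≤-refl
    ... | yes w<v | no  w≮u = ⊥-elim (w≮u (<-trans w<v v<u))
    ... | no  _   | _       = z≤n
    strict : keepIf (rank v <? rank v) 1 < keepIf (rank v <? rank u) 1
    strict with rank v <? rank v | rank v <? rank u
    ... | yes v<v | _       = ⊥-elim (<-irrefl refl v<v)
    ... | no  _   | yes _   = s≤s z≤n
    ... | no  _   | no  v≮u = ⊥-elim (v≮u v<u)

  rank<-bound : ∀ u → rank< u < g
  rank<-bound u = subst (rank< u <_) (sum-const-1 g) (sum-mono-< ≤1 u strict)
    where
    ≤1 : ∀ w → keepIf (rank w <? rank u) 1 ≤ 1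
    ≤1 w with rank w <? rank u
    ... | yes _ = s≤s z≤n
    ... | no  _ = z≤n
    strict : keepIf (rank u <? rank u) 1 < 1
    strict with rank u <? rank u
    ... | yes u<u = ⊥-elim (<-irrefl refl u<u)
    ... | no  _   = s≤s z≤n

bit-irrelevant : ∀ {n m} .{{_ : NonZero m}} (C C′ : Circuit n m) x β → bit C x β ≡ bit C′ x β
bit-irrelevant C C′ x true  = refl
bit-irrelevant C C′ x false = refl

label-cases : ∀ {n m} (C : Circuit n m) u →
              (∃ λ i → Circuit.label C u ≡ input i) ⊎ (∃ λ R → Circuit.label C u ≡ modg R)
label-cases C u with Circuit.label C u
... | input i = inj₁ (i , refl)
... | modg R  = inj₂ (R , refl)

module _ {n m} .{{_ : NonZero m}} (C : Circuit n m) (x : Fin n → Bool) where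
  open Circuit C

  evalF-input : ∀ k u i → label u ≡ input i → evalF C x (suc k) u ≡ x i
  evalF-input k u i eq with label u
  evalF-input k u i refl | .(input i) = refl

  evalF-modg : ∀ k u R → label u ≡ modg R →
               evalF C x (suc k) u ≡ R (sum (λ v → W u v * bit C x (evalF C x k v)) mod m)
  evalF-modg k u R eq with label u
  evalF-modg k u R refl | .(modg R) = cong (λ s → R (s mod m)) (Σ≡sum g _)

  evalF-stable : ∀ k k′ u → rank< C u < k → rank< C u < k′ → evalF C x k u ≡ evalF C x k′ u
  evalF-stable (suc k) (suc k′) u (s≤s u<k) (s≤s u<k′) with label-cases C u
  ... | inj₁ (i , eq) = trans (evalF-input k u i eq) (sym (evalF-input k′ u i eq))
  ... | inj₂ (R , eq) = begin
    evalF C x (suc k) u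
      ≡⟨ evalF-modg k u R eq ⟩
    R (sum (λ v → W u v * bit C x (evalF C x k v)) mod m)
      ≡⟨ cong (λ s → R (s mod m)) (sum-cong-weighted (W u) stable) ⟩
    R (sum (λ v → W u v * bit C x (evalF C x k′ v)) mod m)
      ≡⟨ evalF-modg k′ u R eq ⟨
    evalF C x (suc k′) u
      ∎
    where
    open ≡-Reasoning
    stable : ∀ v → W u v ≢ 0 → bit C x (evalF C x k v) ≡ bit C x (evalF C x k′ v)
    stable v uv≢0 = cong (bit C x) (evalF-stable k k′ v (<-≤-trans v<u u<k) (<-≤-trans v<u u<k′))
      where v<u = rank<-dec C u v uv≢0

  value≡evalF : ∀ u → value C x u ≡ evalF C x (suc (rank< C u)) u
  value≡evalF u = evalF-stable g (suc (rank< C u)) u (rank<-bound C u) ≤-refl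

  value-input : ∀ u i → label u ≡ input i → value C x u ≡ x i
  value-input u i eq = trans (value≡evalF u) (evalF-input (rank< C u) u i eq)

  value-modg : ∀ u R → label u ≡ modg R →
               value C x u ≡ R (sum (λ v → W u v * bit C x (value C x v)) mod m)
  value-modg u R eq = begin
    value C x u
      ≡⟨ value≡evalF u ⟩
    evalF C x (suc (rank< C u)) u
      ≡⟨ evalF-modg (rank< C u) u R eq ⟩
    R (sum (λ v → W u v * bit C x (evalF C x (rank< C u) v)) mod m)
      ≡⟨ cong (λ s → R (s mod m)) (sum-cong-weighted (W u) settled) ⟩
    R (sum (λ v → W u v * bit C x (value C x v)) mod m)
      ∎
    where
    open ≡-Reasoning
    settled : ∀ v → W u v ≢ 0 → bit C x (evalF C x (rank< C u) v) ≡ bit C x (value C x v)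
    settled v uv≢0 = cong (bit C x) (evalF-stable (rank< C u) g v (rank<-dec C u v uv≢0) (rank<-bound C v))

-- Automorphisms and twins

⟨$⟩ʳ-injective : ∀ {g} (σ : Permutation′ g) {u w} → σ ⟨$⟩ʳ u ≡ σ ⟨$⟩ʳ w → u ≡ w
⟨$⟩ʳ-injective σ {u} {w} eq = trans (sym (inverseˡ σ)) (trans (cong (σ ⟨$⟩ˡ_) eq) (inverseˡ σ))

module _ {n m} (C : Circuit n m) where
  open Circuit C

  AutomorphismOver : Permutation′ n → Permutation′ g → Set
  AutomorphismOver π σ = IsAutomorphism C σ × (∀ i → σ ⟨$⟩ʳ inp i ≡ inp (π ⟨$⟩ʳ i))

  automorphism-fixes-out : ∀ σ → IsAutomorphism C σ → σ ⟨$⟩ʳ out ≡ out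
  automorphism-fixes-out σ (_ , σ-W) with σ ⟨$⟩ʳ out ≟ out
  ... | yes σout≡out = σout≡out
  ... | no  σout≢out with others-parent (σ ⟨$⟩ʳ out) σout≢out
  ...   | u , W≢0 = ⊥-elim (W≢0 (begin
    W u (σ ⟨$⟩ʳ out)                    ≡⟨ cong (λ z → W z (σ ⟨$⟩ʳ out)) (inverseʳ σ) ⟨
    W (σ ⟨$⟩ʳ (σ ⟨$⟩ˡ u)) (σ ⟨$⟩ʳ out)  ≡⟨ σ-W (σ ⟨$⟩ˡ u) out ⟩
    W (σ ⟨$⟩ˡ u) out                    ≡⟨ out-noparent (σ ⟨$⟩ˡ u) ⟩
    0                                   ∎))
    where open ≡-Reasoning

  automorphism-maps-input : ∀ {π σ} → AutomorphismOver π σ →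
                            ∀ u i → label u ≡ input i → label (σ ⟨$⟩ʳ u) ≡ input (π ⟨$⟩ʳ i)
  automorphism-maps-input {π} {σ} (_ , σ-inp) u i eq =
    trans (cong (label ∘ (σ ⟨$⟩ʳ_)) (inp-unique u i eq)) (trans (cong label (σ-inp i)) (inp-label _))

  inverse-automorphism : ∀ {π σ} → AutomorphismOver π σ → AutomorphismOver (flip π) (flip σ)
  inverse-automorphism {π} {σ} σ-aut@((σ-label , σ-W) , σ-inp) = (σ⁻¹-label , σ⁻¹-W) , σ⁻¹-inp
    where
    σ⁻¹-inp : ∀ i → σ ⟨$⟩ˡ inp i ≡ inp (π ⟨$⟩ˡ i)
    σ⁻¹-inp i =
      ⟨$⟩ʳ-injective σ (trans (inverseʳ σ) (trans (cong inp (sym (inverseʳ π))) (sym (σ-inp _))))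
    σ⁻¹-label : ∀ u R → label u ≡ modg R → label (σ ⟨$⟩ˡ u) ≡ modg R
    σ⁻¹-label u R eq with label-cases C (σ ⟨$⟩ˡ u)
    ... | inj₂ (S , eq′) =
      trans eq′ (trans (sym (σ-label _ S eq′)) (trans (cong label (inverseʳ σ)) eq))
    ... | inj₁ (i , eq′)
      with trans (sym eq) (trans (cong label (sym (inverseʳ σ)))
                                 (automorphism-maps-input {π} {σ} σ-aut _ i eq′))
    ... | ()
    σ⁻¹-W : ∀ u v → W (σ ⟨$⟩ˡ u) (σ ⟨$⟩ˡ v) ≡ W u v
    σ⁻¹-W u v = trans (sym (σ-W (σ ⟨$⟩ˡ u) (σ ⟨$⟩ˡ v))) (cong₂ W (inverseʳ σ) (inverseʳ σ))

  -- Agreeing on being the output keeps the merged output gate the only gate without parents.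
  record Twin (u w : Fin g) : Set where
    field
      labels   : label u ≈ᴸ label w
      out⇒out  : u ≡ out → w ≡ out
      out⇐out  : w ≡ out → u ≡ out
      children : ∀ y → W u y ≡ W w y

  open Twin public

  twin-refl : ∀ u → Twin u u
  twin-refl u = record
    { labels = ≈ᴸ-refl (label u) ; out⇒out = λ eq → eq ; out⇐out = λ eq → eq ; children = λ _ → refl }

  twin-sym : ∀ {u w} → Twin u w → Twin w u
  twin-sym t = record
    { labels   = ≈ᴸ-sym _ _ (labels t)
    ; out⇒out  = out⇐out t
    ; out⇐out  = out⇒out t
    ; children = sym ∘ children t
    }

  twin-trans : ∀ {u v w} → Twin u v → Twin v w → Twin u w
  twin-trans t t′ = record
    { labels   = ≈ᴸ-trans _ _ _ (labels t) (labels t′)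
    ; out⇒out  = out⇒out t′ ∘ out⇒out t
    ; out⇐out  = out⇐out t ∘ out⇐out t′
    ; children = λ y → trans (children t y) (children t′ y)
    }

  twin? : ∀ u w → Dec (Twin u w)
  twin? u w = map′
    (λ (l , o , o′ , c) → record { labels = l ; out⇒out = o ; out⇐out = o′ ; children = c })
    (λ t → labels t , out⇒out t , out⇐out t , children t)
    (label u ≈ᴸ? label w ×-dec ((u ≟ out) →-dec (w ≟ out)) ×-dec ((w ≟ out) →-dec (u ≟ out))
      ×-dec all? (λ y → W u y ≟ℕ W w y))

  twin-isDecEquivalence : IsDecEquivalence Twin
  twin-isDecEquivalence = record
    { isEquivalence = record { refl = twin-refl _ ; sym = twin-sym ; trans = twin-trans }
    ; _≟_           = twin?
    }

  module _ {π σ} (σ-aut : AutomorphismOver π σ) where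
    private
      σ-label = proj₁ (proj₁ σ-aut)
      σ-W     = proj₂ (proj₁ σ-aut)
      σ-out   = automorphism-fixes-out σ (proj₁ σ-aut)

    twin-labels-image : ∀ {u w} → label u ≈ᴸ label w →
                        u ≡ w ⊎ label (σ ⟨$⟩ʳ u) ≈ᴸ label (σ ⟨$⟩ʳ w)
    twin-labels-image {u} {w} u≈w with label-cases C u | label-cases C w
    ... | inj₁ (i , eu) | inj₁ (j , ew) =
      inj₁ (trans (inp-unique u i eu)
                  (trans (cong inp (subst₂ _≈ᴸ_ eu ew u≈w)) (sym (inp-unique w j ew))))
    ... | inj₁ (i , eu) | inj₂ (S , ew) = ⊥-elim (subst₂ _≈ᴸ_ eu ew u≈w)
    ... | inj₂ (R , eu) | inj₁ (j , ew) = ⊥-elim (subst₂ _≈ᴸ_ eu ew u≈w)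
    ... | inj₂ (R , eu) | inj₂ (S , ew) =
      inj₂ (subst₂ _≈ᴸ_ (sym (σ-label u R eu)) (sym (σ-label w S ew)) (subst₂ _≈ᴸ_ eu ew u≈w))

    automorphism-preserves-twins : ∀ {u w} → Twin u w → Twin (σ ⟨$⟩ʳ u) (σ ⟨$⟩ʳ w)
    automorphism-preserves-twins {u} {w} t with twin-labels-image (labels t)
    ... | inj₁ refl = twin-refl _
    ... | inj₂ σu≈σw = record
      { labels   = σu≈σw
      ; out⇒out  = λ eq → trans (cong (σ ⟨$⟩ʳ_) (out⇒out t (from-out eq))) σ-out
      ; out⇐out  = λ eq → trans (cong (σ ⟨$⟩ʳ_) (out⇐out t (from-out eq))) σ-out
      ; children = λ y → begin
          W (σ ⟨$⟩ʳ u) y                    ≡⟨ cong (W (σ ⟨$⟩ʳ u)) (inverseʳ σ) ⟨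
          W (σ ⟨$⟩ʳ u) (σ ⟨$⟩ʳ (σ ⟨$⟩ˡ y))  ≡⟨ σ-W u _ ⟩
          W u (σ ⟨$⟩ˡ y)                    ≡⟨ children t _ ⟩
          W w (σ ⟨$⟩ˡ y)                    ≡⟨ σ-W w _ ⟨
          W (σ ⟨$⟩ʳ w) (σ ⟨$⟩ʳ (σ ⟨$⟩ˡ y))  ≡⟨ cong (W (σ ⟨$⟩ʳ w)) (inverseʳ σ) ⟩
          W (σ ⟨$⟩ʳ w) y                    ∎
      }
      where
      open ≡-Reasoning
      from-out : ∀ {v} → σ ⟨$⟩ʳ v ≡ out → v ≡ out
      from-out eq = ⟨$⟩ʳ-injective σ (trans eq (sym σ-out))

  row-fixed : ∀ σ → (∀ u v → W (σ ⟨$⟩ʳ u) (σ ⟨$⟩ʳ v) ≡ W u v) →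
              ∀ u → (∀ v → W u v ≢ 0 → σ ⟨$⟩ʳ v ≡ v) → ∀ y → W (σ ⟨$⟩ʳ u) y ≡ W u y
  row-fixed σ σ-W u fixes y =
    trans (cong (W (σ ⟨$⟩ʳ u)) (sym (inverseʳ σ))) (trans (σ-W u (σ ⟨$⟩ˡ y)) preimage)
    where
    preimage : W u (σ ⟨$⟩ˡ y) ≡ W u y
    preimage with W u y ≟ℕ 0 | W u (σ ⟨$⟩ˡ y) ≟ℕ 0
    ... | no  uy≢0 | _          = cong (W u) (trans (cong (σ ⟨$⟩ˡ_) (sym (fixes y uy≢0))) (inverseˡ σ))
    ... | yes _    | no  uy′≢0  = cong (W u) (trans (sym (fixes _ uy′≢0)) (inverseʳ σ))
    ... | yes uy≡0 | yes uy′≡0 = trans uy′≡0 (sym uy≡0)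

  twins-trivial⇒rigid : (∀ u w → Twin u w → u ≡ w) → Rigid C
  twins-trivial⇒rigid trivial σ σ-aut@(σ-label , σ-W) fixes-inputs u = fixed (suc (rank u)) u ≤-refl
    where
    fixed : ∀ N u → rank u < N → σ ⟨$⟩ʳ u ≡ u
    fixed (suc N) u (s≤s u≤N) with label-cases C u
    ... | inj₁ (i , eq) =
      trans (cong (σ ⟨$⟩ʳ_) (inp-unique u i eq)) (trans (fixes-inputs i) (sym (inp-unique u i eq)))
    ... | inj₂ (R , eq) = trivial _ _ record
      { labels   = subst₂ _≈ᴸ_ (sym (σ-label u R eq)) (sym eq) (≈ᴸ-refl {n} (modg R))
      ; out⇒out  = λ σu≡out → ⟨$⟩ʳ-injective σ (trans σu≡out (sym σ-out))
      ; out⇐out  = λ u≡out → trans (cong (σ ⟨$⟩ʳ_) u≡out) σ-out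
      ; children = row-fixed σ σ-W u (λ v uv≢0 → fixed N v (≤-trans (rank-dec u v uv≢0) u≤N)) }
      where σ-out = automorphism-fixes-out σ σ-aut

-- Merging twins

size≡ : ∀ {n m} (C : Circuit n m) → size C ≡ Circuit.g C + sum (λ u → sum (Circuit.W C u))
size≡ C = cong (g +_) (trans (Σ≡sum g _) (sum-cong-≗ λ u → Σ≡sum g (W u)))
  where open Circuit C

module Merge {n m} (C : Circuit n m) where
  open Circuit C
  Q : Quotient (Twin C) rank
  Q = quotient (twin-isDecEquivalence C) rank

  open Quotient Q public

  mergedW : Fin classes → Fin classes → ℕ
  mergedW a b = sum λ w → keepIf (class w ≟ b) (W (rep a) w)

  mergedLabel : Fin classes → Label n m
  mergedLabel a = normalise (label (rep a))

  mergedLabel-class : ∀ u → mergedLabel (class u) ≡ normalise (label u)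
  mergedLabel-class u = normalise-cong _ _ (labels (rep-≈ u))

  mergedW-class : ∀ u b → mergedW (class u) b ≡ sum λ w → keepIf (class w ≟ b) (W u w)
  mergedW-class u b = sum-cong-≗ λ w → cong (keepIf _) (children (rep-≈ u) w)

  W≤mergedW : ∀ u w → W u w ≤ mergedW (class u) (class w)
  W≤mergedW u w = begin
    W u w                                          ≡⟨ keepIf-yes (class w ≟ class w) refl (W u w) ⟨
    keepIf (class w ≟ class w) (W u w)             ≤⟨ ≤-sum _ w ⟩
    sum (λ v → keepIf (class v ≟ class w) (W u v)) ≡⟨ mergedW-class u (class w) ⟨
    mergedW (class u) (class w)                    ∎
    where open ≤-Reasoning

  merged : Circuit n m
  merged = record
    { g             = classes
    ; label         = mergedLabel
    ; W             = mergedW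
    ; rank          = rank ∘ rep
    ; rank-dec      = rank-dec′
    ; inp           = class ∘ inp
    ; inp-label     = λ i → trans (mergedLabel-class (inp i)) (cong normalise (inp-label i))
    ; inp-unique    = λ b i eq →
                        trans (sym (class-rep b)) (cong class (inp-unique (rep b) i (normalise-input _ i eq)))
    ; inp-leaf      = λ b i b′ eq → sum-zero λ w →
                        trans (cong (keepIf _) (inp-leaf (rep b) i w (normalise-input _ i eq))) (keepIf-zero _)
    ; out           = class out
    ; out-noparent  = out-noparent′
    ; others-parent = others-parent′
    }
    where
    -- Representatives have minimal rank in their class, so rank ∘ rep decreases along wires.
    rank-dec′ : ∀ a b → mergedW a b ≢ 0 → rank (rep b) < rank (rep a)
    rank-dec′ a b ab≢0 with sum≢0⇒∃≢0 _ ab≢0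
    ... | w , keep≢0 with class w ≟ b
    ...   | yes refl = ≤-<-trans (rep-minimal w) (rank-dec (rep a) w keep≢0)
    ...   | no  _    = ⊥-elim (keep≢0 refl)
    out-noparent′ : ∀ a → mergedW a (class out) ≡ 0
    out-noparent′ a = sum-zero λ w → none w (class w ≟ class out)
      where
      none : ∀ w (d : Dec (class w ≡ class out)) → keepIf d (W (rep a) w) ≡ 0
      none w (yes eq) = trans (cong (W (rep a)) (out⇐out (class-sound eq) refl)) (out-noparent (rep a))
      none w (no _)   = refl
    others-parent′ : ∀ b → b ≢ class out → ∃ λ a → mergedW a b ≢ 0
    others-parent′ b b≢out
      with others-parent (rep b) (λ eq → b≢out (trans (sym (class-rep b)) (cong class eq)))
    ... | u , W≢0 = class u , λ eq → W≢0 (n≤0⇒n≡0 (≤-trans (W≤mergedW u (rep b))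
                                          (≤-reflexive (trans (cong (mergedW (class u)) (class-rep b)) eq))))

  module _ .{{_ : NonZero m}} (x : Fin n → Bool) where

    merged-children-sum : ∀ u (v : Fin classes → Bool) →
      sum (λ b → mergedW (class u) b * bit merged x (v b)) ≡ sum (λ w → W u w * bit C x (v (class w)))
    merged-children-sum u v = begin
      sum (λ b → mergedW (class u) b * bit merged x (v b))
        ≡⟨ sum-cong-≗ (λ b → trans (cong (_* _) (mergedW-class u b)) (*-distribʳ-sum _ (weight b))) ⟩
      sum (λ b → sum (λ w → keepIf (class w ≟ b) (W u w) * bit merged x (v b)))
        ≡⟨ sum-cong-≗ (λ b → sum-cong-≗ λ w → fibre-term w b) ⟩
      sum (λ b → sum (λ w → keepIf (class w ≟ b) (W u w * bit C x (v (class w)))))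
        ≡⟨ sum-fibres class _ ⟩
      sum (λ w → W u w * bit C x (v (class w)))
        ∎
      where
      open ≡-Reasoning
      weight : Fin classes → Fin g → ℕ
      weight b w = keepIf (class w ≟ b) (W u w)
      fibre-term : ∀ w b → weight b w * bit merged x (v b)
                         ≡ keepIf (class w ≟ b) (W u w * bit C x (v (class w)))
      fibre-term w b with class w ≟ b
      ... | yes refl = cong (W u w *_) (bit-irrelevant merged C x (v b))
      ... | no  _    = refl

    merged-value : ∀ N u → rank u < N → value merged x (class u) ≡ value C x u
    merged-value (suc N) u (s≤s u≤N) with label-cases C u
    ... | inj₁ (i , eq) =
      trans (value-input merged x (class u) i (trans (mergedLabel-class u) (cong normalise eq)))
            (sym (value-input C x u i eq))
    ... | inj₂ (R , eq) = begin
      value merged x (class u)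
        ≡⟨ value-modg merged x (class u) _ (trans (mergedLabel-class u) (cong normalise eq)) ⟩
      lookup (tabulateᵛ R) (sum (λ b → mergedW (class u) b * bit merged x (value merged x b)) mod m)
        ≡⟨ lookup∘tabulate R _ ⟩
      R (sum (λ b → mergedW (class u) b * bit merged x (value merged x b)) mod m)
        ≡⟨ cong (λ s → R (s mod m)) (merged-children-sum u (value merged x)) ⟩
      R (sum (λ w → W u w * bit C x (value merged x (class w))) mod m)
        ≡⟨ cong (λ s → R (s mod m)) (sum-cong-weighted (W u) λ w uw≢0 →
             cong (bit C x) (merged-value N w (≤-trans (rank-dec u w uw≢0) u≤N))) ⟩
      R (sum (λ w → W u w * bit C x (value C x w)) mod m)
        ≡⟨ value-modg C x u R eq ⟨
      value C x u
        ∎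
      where open ≡-Reasoning

    merged-output : output merged x ≡ output C x
    merged-output = merged-value (suc (rank out)) out ≤-refl

  merged-size : size merged ≤ size C
  merged-size = begin
    size merged
      ≡⟨ size≡ merged ⟩
    classes + sum (λ a → sum (λ b → mergedW a b))
      ≡⟨ cong (classes +_) (sum-cong-≗ λ a → sum-fibres class (W (rep a))) ⟩
    classes + sum (λ a → sum (W (rep a)))
      ≤⟨ +-mono-≤ classes≤ (sum-∘-injective rep rep-injective (sum ∘ W)) ⟩
    g + sum (λ u → sum (W u))
      ≡⟨ size≡ C ⟨
    size C
      ∎
    where open ≤-Reasoning

  merged-symmetric : ∀ Γ → Symmetric Γ C → Symmetric Γ merged
  merged-symmetric Γ C-sym π π∈Γ with C-sym π π∈Γ
  ... | σ , σ-aut@((σ-label , σ-W) , σ-inp) = σ′ , (σ′-label , σ′-W) , σ′-inp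
    where
    twins-image    = automorphism-preserves-twins C {π} {σ} σ-aut
    twins-preimage = automorphism-preserves-twins C {flip π} {flip σ}
                       (inverse-automorphism C {π} {σ} σ-aut)
    σ′ : Permutation′ classes
    σ′ = quotient-permutation Q σ twins-image twins-preimage
    σ′-class : ∀ u → σ′ ⟨$⟩ʳ class u ≡ class (σ ⟨$⟩ʳ u)
    σ′-class = quotient-permutation-class Q σ twins-image twins-preimage
    σ′-label : ∀ a R → mergedLabel a ≡ modg R → mergedLabel (σ′ ⟨$⟩ʳ a) ≡ modg R
    σ′-label a R eq with normalise-modg _ R eq
    ... | S , rep-a = trans (mergedLabel-class (σ ⟨$⟩ʳ rep a))
                            (trans (cong normalise (trans (σ-label (rep a) S rep-a) (sym rep-a))) eq)
    σ′-W : ∀ a b → mergedW (σ′ ⟨$⟩ʳ a) (σ′ ⟨$⟩ʳ b) ≡ mergedW a b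
    σ′-W a b = begin
      mergedW (class (σ ⟨$⟩ʳ rep a)) (σ′ ⟨$⟩ʳ b)
        ≡⟨ mergedW-class _ _ ⟩
      sum (λ w → keepIf (class w ≟ σ′ ⟨$⟩ʳ b) (W (σ ⟨$⟩ʳ rep a) w))
        ≡⟨ ∑-permute _ σ ⟩
      sum (λ w → keepIf (class (σ ⟨$⟩ʳ w) ≟ σ′ ⟨$⟩ʳ b) (W (σ ⟨$⟩ʳ rep a) (σ ⟨$⟩ʳ w)))
        ≡⟨ sum-cong-≗ term ⟩
      sum (λ w → keepIf (class w ≟ b) (W (rep a) w))
        ∎
      where
      open ≡-Reasoning
      term : ∀ w → keepIf (class (σ ⟨$⟩ʳ w) ≟ σ′ ⟨$⟩ʳ b) (W (σ ⟨$⟩ʳ rep a) (σ ⟨$⟩ʳ w))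
                 ≡ keepIf (class w ≟ b) (W (rep a) w)
      term w = trans (cong (keepIf _) (σ-W (rep a) w))
        (keepIf-cong (class (σ ⟨$⟩ʳ w) ≟ σ′ ⟨$⟩ʳ b) (class w ≟ b)
          (λ eq → ⟨$⟩ʳ-injective σ′ (trans (σ′-class w) eq))
          (λ eq → trans (sym (σ′-class w)) (cong (σ′ ⟨$⟩ʳ_) eq))
          _)
    σ′-inp : ∀ i → σ′ ⟨$⟩ʳ class (inp i) ≡ class (inp (π ⟨$⟩ʳ i))
    σ′-inp i = trans (σ′-class (inp i)) (cong class (σ-inp i))

distinct-twins? : ∀ {n m} (C : Circuit n m) → Dec (∃₂ λ u w → Twin C u w × u ≢ w)
distinct-twins? C = any? λ u → any? λ w → twin? C u w ×-dec ¬? (u ≟ w)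

module _ {n m : ℕ} .{{_ : NonZero m}} (Γ : Permutation′ n → Set) where

  Rigidification : Circuit n m → Set
  Rigidification C = Σ (Circuit n m) λ C′ → Rigid C′ × Symmetric Γ C′ ×
    (∀ (x : Fin n → Bool) → output C′ x ≡ output C x) × (size C′ ≤ size C)

  rigidification-of-merged : ∀ C → Rigidification (Merge.merged C) → Rigidification C
  rigidification-of-merged C (C′ , rigid , symmetric , same-output , smaller) =
    C′ , rigid , symmetric , (λ x → trans (same-output x) (Merge.merged-output C x)) ,
    ≤-trans smaller (Merge.merged-size C)

  rigidify : ∀ N (C : Circuit n m) → Circuit.g C ≤ N → Symmetric Γ C → Rigidification C
  rigidify zero C g≤0 _ = ⊥-elim (n≮0 (<-≤-trans (toℕ<n (Circuit.out C)) g≤0))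
  rigidify (suc N) C g≤N C-sym with distinct-twins? C
  ... | no none = C , twins-trivial⇒rigid C no-twins , C-sym , (λ _ → refl) , ≤-refl
    where
    no-twins : ∀ u w → Twin C u w → u ≡ w
    no-twins u w t = decidable-stable (u ≟ w) λ u≢w → none (u , w , t , u≢w)
  ... | yes (u , w , t , u≢w) = rigidification-of-merged C
    (rigidify N (Merge.merged C) (≤-pred (≤-trans (Merge.classes< C t u≢w) g≤N))
              (Merge.merged-symmetric C Γ C-sym))

lemmaA1 : (n m : ℕ) → .{{_ : NonZero m}} → (Γ : Permutation′ n → Set) → IsSubgroup Γ →
    (C : Circuit n m) → Symmetric Γ C →
    Σ (Circuit n m) λ C′ → Rigid C′ × Symmetric Γ C′ ×
      (∀ (x : Fin n → Bool) → output C′ x ≡ output C x) × (size C′ ≤ size C)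
lemmaA1 n m Γ _ C C-sym = rigidify Γ (Circuit.g C) C ≤-refl C-sym
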